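{- Let $G$ be a finite simple graph on $n$ vertices. If \[ \delta(G) \geq \frac{n}{2} + \frac{\ln n}{\ln (4/3)}, \] then $\overrightarrow{\mathrm{diam}}(G) = 2$, i.e., $G$ has an orientation of diameter two.
   Context: $\delta(G)$ denotes the minimum degree of $G$ and $\ln$ is the natural logarithm. An orientation of $G$ is a digraph obtained by assigning a direction to each edge of $G$. A digraph is strong if there is a directed path between any ordered pair of vertices; the diameter of a strong digraph is the maximum, over ordered pairs $(u,v)$ of vertices, of the length of a shortest directed $(u,v)$-path. The oriented diameter $\overrightarrow{\mathrm{diam}}(G)$ of a graph $G$ is the minimum diameter among all strong orientations of $G$. An orientation has diameter two means that for every ordered pair of distinct vertices $u,v$ there is a directed path of length at most $2$ from $u$ to $v$ (and some pair is non-adjacent or the diameter is otherwise not $1$). -}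

module Defs where

open import Data.Nat using (ℕ; zero; suc; _+_; _*_; _∸_; _^_; _≤_; _⊓_)
open import Data.Fin using (Fin; zero; suc)
open import Data.Bool using (Bool; true; false; if_then_else_)
open import Data.Product using (Σ; ∃; _×_; _,_)
open import Data.Sum using (_⊎_)
open import Relation.Binary.PropositionalEquality using (_≡_; _≢_)
open import Relation.Nullary using (¬_)

record Graph (n : ℕ) : Set where
  field
    adj   : Fin n → Fin n → Bool
    sym   : ∀ u v → adj u v ≡ adj v u
    irrefl : ∀ u → adj u u ≡ false
open Graph public

countTrue : ∀ {n} → (Fin n → Bool) → ℕ
countTrue {zero}  f = 0
countTrue {suc n} f = (if f zero then 1 else 0) + countTrue (λ i → f (suc i))

degree : ∀ {n} → Graph n → Fin n → ℕ
degree G u = countTrue (adj G u)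

minOver : ∀ {n} → (Fin (suc n) → ℕ) → ℕ
minOver {zero}  f = f zero
minOver {suc n} f = f zero ⊓ minOver (λ i → f (suc i))

minDegree : ∀ {n} → Graph (suc n) → ℕ
minDegree G = minOver (degree G)

record Orientation {n : ℕ} (G : Graph n) : Set where
  field
    arc      : Fin n → Fin n → Bool
    arc⇒edge : ∀ u v → arc u v ≡ true → adj G u v ≡ true
    edge⇒arc : ∀ u v → adj G u v ≡ true → (arc u v ≡ true) ⊎ (arc v u ≡ true)
    antisym  : ∀ u v → arc u v ≡ true → arc v u ≡ false
open Orientation public

Reach≤2 : ∀ {n} {G : Graph n} → Orientation G → Fin n → Fin n → Set
Reach≤2 D u v = (arc D u v ≡ true) ⊎ (∃ λ w → (arc D u w ≡ true) × (arc D w v ≡ true))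

-- D is strong with diameter exactly two: every ordered pair of distinct
-- vertices is joined by a directed path of length ≤ 2, and the diameter is
-- not 1 (some ordered pair of distinct vertices has no arc u → v).
HasDiameterTwo : ∀ {n} {G : Graph n} → Orientation G → Set
HasDiameterTwo {n} D =
  (∀ u v → u ≢ v → Reach≤2 D u v) ×
  (∃ λ u → ∃ λ v → (u ≢ v) × (arc D u v ≡ false))

-- The real-number condition δ ≥ n/2 + ln n / ln(4/3), for n ≥ 1, rewritten
-- exactly in ℕ:  2δ ≥ n  and  (4/3)^(2δ-n) ≥ n², i.e. n² · 3^(2δ-n) ≤ 4^(2δ-n).
DegreeCondition : ℕ → ℕ → Set
DegreeCondition n δ = (n ≤ 2 * δ) × (n * n * 3 ^ (2 * δ ∸ n) ≤ 4 ^ (2 * δ ∸ n))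

module Submission where

-- Orient every edge by a fair coin. For u ≢ v, each common neighbour w of u
-- and v completes the path u → w → v with probability 1/4, independently over
-- w because these paths use pairwise disjoint edges. Since u and v have at
-- least 2δ − n common neighbours, u fails to reach v in two steps with
-- probability at most (3/4)^(2δ−n) ≤ 1/n², and a union bound over the
-- n(n − 1) ordered pairs leaves a coin outcome in which every pair succeeds.
-- Probabilities are replaced by exact counts over all coin vectors.

open import Defs hiding (sym)
open import Data.Bool using (Bool; true; false; not; _∧_; _∨_; _xor_; if_then_else_)
open import Data.Bool.Properties
  using (∧-assoc; ∧-conicalˡ; ∧-conicalʳ; not-injective; not-distribˡ-xor; not-distribʳ-xor)
open import Data.Fin using (Fin; zero; suc; combine; punchIn; punchOut)
open import Data.Fin.Properties
  using (<-cmp; combine-injective; suc-injective; 0≢1+n; punchInᵢ≢i; punchIn-punchOut)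
  renaming (_<?_ to _<ᶠ?_)
open import Data.Nat using (ℕ; zero; suc; _+_; _*_; _∸_; _^_; _≤_; _<_; z≤n; s≤s; _<?_; NonZero; >-nonZero)
open import Data.Nat.Properties
  using ( ≤-refl; ≤-reflexive; ≤-trans; ≮⇒≥; n<1+n; n≤1+n; <-irrefl; +-identityʳ; +-suc; +-comm
        ; +-mono-≤; +-monoˡ-≤; +-cancelˡ-≡; +-cancelˡ-<; *-assoc; *-zeroʳ; *-distribˡ-+
        ; *-monoˡ-≤; *-monoʳ-≤; *-monoˡ-<; *-monoʳ-<; *-cancelˡ-≤; *-cancelˡ-<; m*n≢0
        ; ^-distribˡ-+-*; ^-monoˡ-≤; m^n≢0; m^n>0; m∸n+n≡m; m≤n+o⇒m∸n≤o; m⊓n≤m; m⊓n≤n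
        ; *-comm; +-commutativeSemigroup; *-commutativeSemigroup; module ≤-Reasoning)
open import Algebra.Properties.CommutativeSemigroup +-commutativeSemigroup using (interchange)
open import Algebra.Properties.CommutativeSemigroup *-commutativeSemigroup using (x∙yz≈y∙xz)
open import Data.Product using (∃; _×_; _,_; proj₁; proj₂)
open import Data.Sum using (_⊎_; inj₁; inj₂)
open import Data.Vec using (Vec; []; _∷_; lookup; updateAt)
open import Data.Vec.Properties using (lookup∘updateAt; lookup∘updateAt′)
open import Function using (_∘_)
open import Function.Definitions using (Injective)
open import Relation.Binary.Definitions using (tri<; tri≈; tri>)
open import Relation.Binary.PropositionalEquality
  using (_≡_; _≢_; _≗_; refl; sym; trans; cong; cong₂; subst; module ≡-Reasoning)
open import Relation.Nullary using (¬_; yes; no; does; contradiction)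
open import Relation.Nullary.Decidable using (dec-true; dec-false)

-- Counting the coin vectors satisfying a Boolean predicate

count : ∀ {N} → (Vec Bool N → Bool) → ℕ
count {zero}  P = if P [] then 1 else 0
count {suc N} P = count (λ c → P (false ∷ c)) + count (λ c → P (true ∷ c))

count-cong : ∀ {N} {P Q : Vec Bool N → Bool} → P ≗ Q → count P ≡ count Q
count-cong {zero}  P≗Q rewrite P≗Q [] = refl
count-cong {suc N} P≗Q =
  cong₂ _+_ (count-cong (P≗Q ∘ (false ∷_))) (count-cong (P≗Q ∘ (true ∷_)))

count-false : ∀ N → count {N} (λ _ → false) ≡ 0
count-false zero    = refl
count-false (suc N) = cong₂ _+_ (count-false N) (count-false N)

count-true : ∀ N → count {N} (λ _ → true) ≡ 2 ^ N
count-true zero    = refl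
count-true (suc N) = cong₂ _+_ (count-true N) (trans (count-true N) (sym (+-identityʳ _)))

count-mono : ∀ {N} {P Q : Vec Bool N → Bool} →
             (∀ c → P c ≡ true → Q c ≡ true) → count P ≤ count Q
count-mono {zero} {P} P⇒Q with P [] in p
... | false = z≤n
... | true rewrite P⇒Q [] p = ≤-refl
count-mono {suc N} P⇒Q =
  +-mono-≤ (count-mono (P⇒Q ∘ (false ∷_))) (count-mono (P⇒Q ∘ (true ∷_)))

count-∨ : ∀ {N} (P Q : Vec Bool N → Bool) → count (λ c → P c ∨ Q c) ≤ count P + count Q
count-∨ {zero} P Q with P []
... | true  = s≤s z≤n
... | false = ≤-refl
count-∨ {suc N} P Q = ≤-trans
  (+-mono-≤ (count-∨ (P ∘ (false ∷_)) (Q ∘ (false ∷_))) (count-∨ (P ∘ (true ∷_)) (Q ∘ (true ∷_))))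
  (≤-reflexive (interchange (count (P ∘ (false ∷_))) (count (Q ∘ (false ∷_)))
                            (count (P ∘ (true ∷_))) (count (Q ∘ (true ∷_)))))

count-split : ∀ {N} (E P : Vec Bool N → Bool) →
              count P ≡ count (λ c → E c ∧ P c) + count (λ c → not (E c) ∧ P c)
count-split {zero} E P with E []
... | true  = sym (+-identityʳ _)
... | false = refl
count-split {suc N} E P = trans
  (cong₂ _+_ (count-split (E ∘ (false ∷_)) (P ∘ (false ∷_))) (count-split (E ∘ (true ∷_)) (P ∘ (true ∷_))))
  (interchange (count (λ c → E (false ∷ c) ∧ P (false ∷ c))) (count (λ c → not (E (false ∷ c)) ∧ P (false ∷ c)))
               (count (λ c → E (true ∷ c) ∧ P (true ∷ c))) (count (λ c → not (E (true ∷ c)) ∧ P (true ∷ c))))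

count-flip : ∀ {N} (i : Fin N) (P : Vec Bool N → Bool) →
             count (λ c → P (updateAt c i not)) ≡ count P
count-flip zero    P = +-comm (count (P ∘ (true ∷_))) (count (P ∘ (false ∷_)))
count-flip (suc i) P = cong₂ _+_ (count-flip i (P ∘ (false ∷_))) (count-flip i (P ∘ (true ∷_)))

count<2^N⇒∃ : ∀ {N} (P : Vec Bool N → Bool) → count P < 2 ^ N → ∃ λ c → P c ≡ false
count<2^N⇒∃ {zero} P count<1 with P [] in p
... | false = [] , p
... | true  = contradiction count<1 (<-irrefl refl)
count<2^N⇒∃ {suc N} P count<2^[1+N] with count (P ∘ (false ∷_)) <? 2 ^ N
... | yes count₀<2^N = let c , p = count<2^N⇒∃ (P ∘ (false ∷_)) count₀<2^N in false ∷ c , p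
... | no  count₀≮2^N = let c , p = count<2^N⇒∃ (P ∘ (true ∷_)) count₁<2^N in true ∷ c , p
  where
  open ≤-Reasoning
  count₁<2^N : count (P ∘ (true ∷_)) < 2 ^ N
  count₁<2^N = +-cancelˡ-< (2 ^ N) _ _ (begin-strict
    2 ^ N + count (P ∘ (true ∷_))                    ≤⟨ +-monoˡ-≤ _ (≮⇒≥ count₀≮2^N) ⟩
    count (P ∘ (false ∷_)) + count (P ∘ (true ∷_))   <⟨ count<2^[1+N] ⟩
    2 ^ N + (2 ^ N + 0)                              ≡⟨ cong (2 ^ N +_) (+-identityʳ _) ⟩
    2 ^ N + 2 ^ N                                    ∎)

IndependentOf : ∀ {N} → Fin N → (Vec Bool N → Bool) → Set
IndependentOf i P = ∀ c → P (updateAt c i not) ≡ P c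

count-coin-halves : ∀ {N} (i : Fin N) (α : Bool) {P : Vec Bool N → Bool} → IndependentOf i P →
            2 * count (λ c → (α xor lookup c i) ∧ P c) ≡ count P
count-coin-halves i α {P} P⊥i = sym (begin
  count P                     ≡⟨ count-split E P ⟩
  count E∧P + count ¬E∧P      ≡⟨ cong (count E∧P +_) (trans (count-cong flipped) (count-flip i E∧P)) ⟩
  count E∧P + count E∧P       ≡⟨ cong (count E∧P +_) (sym (+-identityʳ _)) ⟩
  2 * count E∧P               ∎)
  where
  open ≡-Reasoning
  E E∧P ¬E∧P : Vec Bool _ → Bool
  E c = α xor lookup c i
  E∧P c = E c ∧ P c
  ¬E∧P c = not (E c) ∧ P c
  flipped : ∀ c → ¬E∧P c ≡ E∧P (updateAt c i not)
  flipped c = cong₂ _∧_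
    (trans (not-distribʳ-xor α (lookup c i)) (cong (α xor_) (sym (lookup∘updateAt i c))))
    (sym (P⊥i c))

count-not-both-coins : ∀ {N} {i j : Fin N} (α β : Bool) {P : Vec Bool N → Bool} → i ≢ j →
  IndependentOf i P → IndependentOf j P →
  4 * count (λ c → not ((α xor lookup c i) ∧ (β xor lookup c j)) ∧ P c) ≡ 3 * count P
count-not-both-coins {i = i} {j} α β {P} i≢j P⊥i P⊥j =
  +-cancelˡ-≡ (count P) _ _ (begin
    count P + 4 * count ¬E∧P                ≡⟨ cong (_+ 4 * count ¬E∧P) (sym both) ⟩
    4 * count E∧P + 4 * count ¬E∧P          ≡⟨ sym (*-distribˡ-+ 4 (count E∧P) (count ¬E∧P)) ⟩
    4 * (count E∧P + count ¬E∧P)            ≡⟨ cong (4 *_) (sym (count-split E P)) ⟩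
    4 * count P                             ∎)
  where
  open ≡-Reasoning
  Eᵢ Eⱼ E E∧P ¬E∧P : Vec Bool _ → Bool
  Eᵢ c = α xor lookup c i
  Eⱼ c = β xor lookup c j
  E c = Eᵢ c ∧ Eⱼ c
  E∧P c = E c ∧ P c
  ¬E∧P c = not (E c) ∧ P c
  Eⱼ∧P⊥i : IndependentOf i (λ c → Eⱼ c ∧ P c)
  Eⱼ∧P⊥i c = cong₂ _∧_ (cong (β xor_) (lookup∘updateAt′ j i (i≢j ∘ sym) c)) (P⊥i c)
  both : 4 * count E∧P ≡ count P
  both = begin
    4 * count E∧P                              ≡⟨ cong (4 *_) (count-cong (λ c → ∧-assoc (Eᵢ c) (Eⱼ c) (P c))) ⟩
    2 * 2 * count (λ c → Eᵢ c ∧ (Eⱼ c ∧ P c))  ≡⟨ *-assoc 2 2 (count (λ c → Eᵢ c ∧ (Eⱼ c ∧ P c))) ⟩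
    2 * (2 * count (λ c → Eᵢ c ∧ (Eⱼ c ∧ P c))) ≡⟨ cong (2 *_) (count-coin-halves i α Eⱼ∧P⊥i) ⟩
    2 * count (λ c → Eⱼ c ∧ P c)               ≡⟨ count-coin-halves j β P⊥j ⟩
    count P                                    ∎

not-∨ : ∀ a b → not (a ∨ b) ≡ not a ∧ not b
not-∨ true  b = refl
not-∨ false b = refl

anyFin : ∀ {m} → (Fin m → Bool) → Bool
anyFin {zero}  f = false
anyFin {suc m} f = f zero ∨ anyFin (f ∘ suc)

anyFin-witness : ∀ {m} (f : Fin m → Bool) → anyFin f ≡ true → ∃ λ i → f i ≡ true
anyFin-witness {suc m} f any with f zero in f₀
... | true  = zero , f₀
... | false = let i , fᵢ = anyFin-witness (f ∘ suc) any in suc i , fᵢ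

anyFin-false : ∀ {m} (f : Fin m → Bool) → anyFin f ≡ false → ∀ i → f i ≡ false
anyFin-false {suc m} f none i with f zero in f₀
anyFin-false {suc m} f none zero    | false = f₀
anyFin-false {suc m} f none (suc i) | false = anyFin-false (f ∘ suc) none i

anyFin-independent : ∀ {m N} {i : Fin N} (F : Fin m → Vec Bool N → Bool) →
  (∀ j → IndependentOf i (F j)) → IndependentOf i (λ c → anyFin (λ j → F j c))
anyFin-independent {zero}  F F⊥i c = refl
anyFin-independent {suc m} F F⊥i c =
  cong₂ _∨_ (F⊥i zero c) (anyFin-independent (F ∘ suc) (F⊥i ∘ suc) c)

count-anyFin : ∀ {m N} s B (F : Fin m → Vec Bool N → Bool) → (∀ j → s * count (F j) ≤ B) →
               s * count (λ c → anyFin (λ j → F j c)) ≤ m * B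
count-anyFin {zero} {N} s B F _ = ≤-reflexive (trans (cong (s *_) (count-false N)) (*-zeroʳ s))
count-anyFin {suc m} s B F bound = begin
  s * count (λ c → F zero c ∨ rest c)     ≤⟨ *-monoʳ-≤ s (count-∨ (F zero) rest) ⟩
  s * (count (F zero) + count rest)       ≡⟨ *-distribˡ-+ s (count (F zero)) (count rest) ⟩
  s * count (F zero) + s * count rest     ≤⟨ +-mono-≤ (bound zero) (count-anyFin s B (F ∘ suc) (bound ∘ suc)) ⟩
  B + m * B                               ∎
  where
  open ≤-Reasoning
  rest : Vec Bool _ → Bool
  rest c = anyFin (λ j → F (suc j) c)

proportion-trans : ∀ {p q a b x′ x t} → p * x′ ≡ q * x → a * x ≡ b * t → p * a * x′ ≡ q * b * t
proportion-trans {p} {q} {a} {b} {x′} {x} {t} px′≡qx ax≡bt = begin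
  p * a * x′    ≡⟨ cong (_* x′) (*-comm p a) ⟩
  a * p * x′    ≡⟨ *-assoc a p x′ ⟩
  a * (p * x′)  ≡⟨ cong (a *_) px′≡qx ⟩
  a * (q * x)   ≡⟨ x∙yz≈y∙xz a q x ⟩
  q * (a * x)   ≡⟨ cong (q *_) ax≡bt ⟩
  q * (b * t)   ≡⟨ *-assoc q b t ⟨
  q * b * t     ∎
  where open ≡-Reasoning

≤-ratio^-weaken : ∀ {a b k l x y} .{{_ : NonZero b}} → a ≤ b → k ≤ l →
                  b ^ l * x ≤ a ^ l * y → b ^ k * x ≤ a ^ k * y
≤-ratio^-weaken {a} {b} {k} {l} {x} {y} a≤b k≤l bˡx≤aˡy = *-cancelˡ-≤ (b ^ d) {{m^n≢0 b d}} (begin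
  b ^ d * (b ^ k * x)  ≡⟨ split b x ⟨
  b ^ (d + k) * x      ≡⟨ cong (λ e → b ^ e * x) (m∸n+n≡m k≤l) ⟩
  b ^ l * x            ≤⟨ bˡx≤aˡy ⟩
  a ^ l * y            ≡⟨ cong (λ e → a ^ e * y) (m∸n+n≡m k≤l) ⟨
  a ^ (d + k) * y      ≡⟨ split a y ⟩
  a ^ d * (a ^ k * y)  ≤⟨ *-monoˡ-≤ (a ^ k * y) (^-monoˡ-≤ d a≤b) ⟩
  b ^ d * (a ^ k * y)  ∎)
  where
  open ≤-Reasoning
  d = l ∸ k
  split : ∀ c z → c ^ (d + k) * z ≡ c ^ d * (c ^ k * z)
  split c z = trans (cong (_* z) (^-distribˡ-+-* c d k)) (*-assoc (c ^ d) (c ^ k) z)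

union-bound-< : ∀ m {a b c t} → 0 < a → 0 < t →
                suc m * suc m * a ≤ b → b * c ≤ suc m * (m * (a * t)) → c < t
union-bound-< m {a} {b} {c} {t} a>0 t>0 n²a≤b bc≤nmat = *-cancelˡ-< b c t (begin-strict
  b * c                    ≤⟨ bc≤nmat ⟩
  n * (m * (a * t))        <⟨ *-monoʳ-< n (*-monoˡ-< (a * t) {{at≢0}} (n<1+n m)) ⟩
  n * (n * (a * t))        ≡⟨ trans (*-assoc (n * n) a t) (*-assoc n n (a * t)) ⟨
  n * n * a * t            ≤⟨ *-monoˡ-≤ t n²a≤b ⟩
  b * t                    ∎)
  where
  open ≤-Reasoning
  n = suc m
  at≢0 : NonZero (a * t)
  at≢0 = m*n≢0 a t {{>-nonZero a>0}} {{>-nonZero t>0}}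

countTrue-∧ : ∀ {n} (f g : Fin n → Bool) →
              countTrue f + countTrue g ≤ n + countTrue (λ i → f i ∧ g i)
countTrue-∧ {zero} f g = z≤n
countTrue-∧ {suc n} f g with f zero | g zero | countTrue-∧ (f ∘ suc) (g ∘ suc)
... | true  | true  | ih rewrite +-suc (countTrue (f ∘ suc)) (countTrue (g ∘ suc))
                               | +-suc n (countTrue (λ i → f (suc i) ∧ g (suc i))) = s≤s (s≤s ih)
... | true  | false | ih = s≤s ih
... | false | true  | ih rewrite +-suc (countTrue (f ∘ suc)) (countTrue (g ∘ suc)) = s≤s ih
... | false | false | ih = ≤-trans ih (+-monoˡ-≤ _ (n≤1+n n))

minOver-≤ : ∀ {n} (f : Fin (suc n) → ℕ) i → minOver f ≤ f i
minOver-≤ {zero}  f zero    = ≤-refl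
minOver-≤ {suc n} f zero    = m⊓n≤m _ _
minOver-≤ {suc n} f (suc i) = ≤-trans (m⊓n≤n _ _) (minOver-≤ (f ∘ suc) i)

commonNeighbour : ∀ {n} → Graph n → Fin n → Fin n → Fin n → Bool
commonNeighbour G u v w = adj G u w ∧ adj G v w

commonNeighbours-≥ : ∀ {m} (G : Graph (suc m)) u v →
                     2 * minDegree G ∸ suc m ≤ countTrue (commonNeighbour G u v)
commonNeighbours-≥ {m} G u v = m≤n+o⇒m∸n≤o (2 * δ) (suc m) (begin
  δ + (δ + 0)                            ≡⟨ cong (δ +_) (+-identityʳ δ) ⟩
  δ + δ                                  ≤⟨ +-mono-≤ (minOver-≤ (degree G) u) (minOver-≤ (degree G) v) ⟩
  degree G u + degree G v                ≤⟨ countTrue-∧ (adj G u) (adj G v) ⟩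
  suc m + countTrue (commonNeighbour G u v) ∎)
  where
  open ≤-Reasoning
  δ = minDegree G

minDegree-single : (G : Graph 1) → minDegree G ≡ 0
minDegree-single G rewrite irrefl G zero = refl

-- The orientation determined by a coin vector

∃-non-arc : ∀ {m} {G : Graph (suc (suc m))} (D : Orientation G) →
            ∃ λ u → ∃ λ v → (u ≢ v) × (arc D u v ≡ false)
∃-non-arc D with arc D zero (suc zero) in 0→1
... | false = zero , suc zero , (λ ()) , 0→1
... | true  = suc zero , zero , (λ ()) , antisym D zero (suc zero) 0→1

module _ {n : ℕ} (G : Graph n) where

  adj⇒≢ : ∀ {x y} → adj G x y ≡ true → x ≢ y
  adj⇒≢ {x} xy refl = contradiction (trans (sym xy) (irrefl G x)) λ ()

  below : Fin n → Fin n → Bool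
  below x y = does (x <ᶠ? y)

  below-flip : ∀ {x y} → x ≢ y → below y x ≡ not (below x y)
  below-flip {x} {y} x≢y with <-cmp x y
  ... | tri< x<y _ y≮x rewrite dec-true (x <ᶠ? y) x<y | dec-false (y <ᶠ? x) y≮x = refl
  ... | tri≈ _ x≡y _   = contradiction x≡y x≢y
  ... | tri> x≮y _ y<x rewrite dec-false (x <ᶠ? y) x≮y | dec-true (y <ᶠ? x) y<x = refl

  -- The coin of the unordered pair {x, y} sits at index combine (min x y) (max x y).
  key : Fin n → Fin n → Fin (n * n)
  key x y = if below x y then combine x y else combine y x

  key-sym : ∀ {x y} → x ≢ y → key y x ≡ key x y
  key-sym {x} {y} x≢y rewrite below-flip x≢y with below x y
  ... | true  = refl
  ... | false = refl

  key-injective : ∀ {x y x′ y′} → key x y ≡ key x′ y′ → (x ≡ x′ × y ≡ y′) ⊎ (x ≡ y′ × y ≡ x′)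
  key-injective {x} {y} {x′} {y′} eq with below x y | below x′ y′
  ... | true  | true  = inj₁ (combine-injective x y x′ y′ eq)
  ... | true  | false = inj₂ (combine-injective x y y′ x′ eq)
  ... | false | true  = let y≡x′ , x≡y′ = combine-injective y x x′ y′ eq in inj₂ (x≡y′ , y≡x′)
  ... | false | false = let y≡y′ , x≡x′ = combine-injective y x y′ x′ eq in inj₁ (x≡x′ , y≡y′)

  key-≢ : ∀ {x y x′ y′} → ¬ (x ≡ x′ × y ≡ y′) → ¬ (x ≡ y′ × y ≡ x′) → key x y ≢ key x′ y′
  key-≢ same swapped eq with key-injective eq
  ... | inj₁ p = same p
  ... | inj₂ p = swapped p

  Coins : Set
  Coins = Vec Bool (n * n)

  arcOf : Coins → Fin n → Fin n → Bool
  arcOf c x y = adj G x y ∧ (below x y xor lookup c (key x y))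

  arcOf-flip : ∀ c {x y} → adj G x y ≡ true → arcOf c y x ≡ not (arcOf c x y)
  arcOf-flip c {x} {y} xy
    rewrite Graph.sym G y x | xy | key-sym (adj⇒≢ xy) | below-flip (adj⇒≢ xy)
    = sym (not-distribˡ-xor (below x y) (lookup c (key x y)))

  orientation : Coins → Orientation G
  orientation c = record
    { arc      = arcOf c
    ; arc⇒edge = λ u v → ∧-conicalˡ _ _
    ; edge⇒arc = edge⇒someArc
    ; antisym  = λ u v uv → trans (arcOf-flip c (∧-conicalˡ _ _ uv)) (cong not uv)
    }
    where
    edge⇒someArc : ∀ u v → adj G u v ≡ true → (arcOf c u v ≡ true) ⊎ (arcOf c v u ≡ true)
    edge⇒someArc u v e with arcOf c u v in uv
    ... | true  = inj₁ refl
    ... | false = inj₂ (trans (arcOf-flip c e) (cong not uv))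

  arcOf-independent : ∀ {i x y} → i ≢ key x y → IndependentOf i (λ c → arcOf c x y)
  arcOf-independent {i} {x} {y} i≢key c =
    cong (λ b → adj G x y ∧ (below x y xor b)) (lookup∘updateAt′ (key x y) i (i≢key ∘ sym) c)

  twoPath : Coins → Fin n → Fin n → Fin n → Bool
  twoPath c u v w = arcOf c u w ∧ arcOf c w v

  reaches≤2 : Coins → Fin n → Fin n → Bool
  reaches≤2 c u v = arcOf c u v ∨ anyFin (twoPath c u v)

  reaches≤2-sound : ∀ c u v → reaches≤2 c u v ≡ true → Reach≤2 (orientation c) u v
  reaches≤2-sound c u v r with arcOf c u v in uv
  ... | true  = inj₁ refl
  ... | false = let w , p = anyFin-witness (twoPath c u v) r in
                inj₂ (w , ∧-conicalˡ (arcOf c u w) _ p , ∧-conicalʳ (arcOf c u w) _ p)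

  twoPath⇒common : ∀ c {u v w} → twoPath c u v w ≡ true → commonNeighbour G u v w ≡ true
  twoPath⇒common c {u} {v} {w} p = cong₂ _∧_
    (∧-conicalˡ _ _ (∧-conicalˡ (arcOf c u w) _ p))
    (trans (Graph.sym G v w) (∧-conicalˡ _ _ (∧-conicalʳ (arcOf c u w) _ p)))

  twoPath-uncommon : ∀ c {u v w} → commonNeighbour G u v w ≡ false → twoPath c u v w ≡ false
  twoPath-uncommon c {u} {v} {w} uncommon with twoPath c u v w in p
  ... | false = refl
  ... | true  = contradiction (trans (sym uncommon) (twoPath⇒common c p)) λ ()

  twoPath-common : ∀ c {u v w} → commonNeighbour G u v w ≡ true →
    twoPath c u v w ≡ (below u w xor lookup c (key u w)) ∧ (below w v xor lookup c (key w v))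
  twoPath-common c {u} {v} {w} common = cong₂
    (λ uw wv → (uw ∧ (below u w xor lookup c (key u w))) ∧ (wv ∧ (below w v xor lookup c (key w v))))
    (∧-conicalˡ _ (adj G v w) common)
    (trans (Graph.sym G w v) (∧-conicalʳ (adj G u w) _ common))

  twoPath-independent : ∀ {u v w w′} → u ≢ v → commonNeighbour G u v w ≡ true → w ≢ w′ →
    IndependentOf (key u w) (λ c → twoPath c u v w′) × IndependentOf (key w v) (λ c → twoPath c u v w′)
  twoPath-independent {u} {v} {w} {w′} u≢v common w≢w′ =
    (λ c → cong₂ _∧_ (arcOf-independent uw≢uw′ c) (arcOf-independent uw≢w′v c)) ,
    (λ c → cong₂ _∧_ (arcOf-independent wv≢uw′ c) (arcOf-independent wv≢w′v c))
    where
    u≢w = adj⇒≢ (∧-conicalˡ _ (adj G v w) common)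
    v≢w = adj⇒≢ (∧-conicalʳ (adj G u w) _ common)
    uw≢uw′  = key-≢ (w≢w′ ∘ proj₂) (u≢w ∘ sym ∘ proj₂)
    uw≢w′v  = key-≢ (v≢w ∘ sym ∘ proj₂) (u≢v ∘ proj₁)
    wv≢uw′  = key-≢ (u≢w ∘ sym ∘ proj₁) (w≢w′ ∘ proj₁)
    wv≢w′v  = key-≢ (w≢w′ ∘ proj₁) (v≢w ∘ sym ∘ proj₁)

  count-avoid-twoPath : ∀ {u v w} {P : Coins → Bool} → u ≢ v → commonNeighbour G u v w ≡ true →
    IndependentOf (key u w) P → IndependentOf (key w v) P →
    4 * count (λ c → not (twoPath c u v w) ∧ P c) ≡ 3 * count P
  count-avoid-twoPath {u} {v} {w} {P} u≢v common P⊥uw P⊥wv = trans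
    (cong (4 *_) (count-cong (λ c → cong (λ b → not b ∧ P c) (twoPath-common c common))))
    (count-not-both-coins (below u w) (below w v) (key-≢ (u≢w ∘ proj₁) (u≢v ∘ proj₁)) P⊥uw P⊥wv)
    where
    u≢w = adj⇒≢ (∧-conicalˡ _ (adj G v w) common)

  avoidsVia : ∀ {m} → Fin n → Fin n → (Fin m → Fin n) → Coins → Bool
  avoidsVia u v ws c = not (anyFin (twoPath c u v ∘ ws))

  avoidsVia-independent : ∀ {m u v i} (ws : Fin m → Fin n) →
    (∀ j → IndependentOf i (λ c → twoPath c u v (ws j))) → IndependentOf i (avoidsVia u v ws)
  avoidsVia-independent {u = u} {v} ws ws⊥i c =
    cong not (anyFin-independent (λ j c → twoPath c u v (ws j)) ws⊥i c)

  count-avoidsVia : ∀ {m u v} → u ≢ v → (ws : Fin m → Fin n) → Injective _≡_ _≡_ ws →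
    4 ^ countTrue (commonNeighbour G u v ∘ ws) * count (avoidsVia u v ws)
      ≡ 3 ^ countTrue (commonNeighbour G u v ∘ ws) * 2 ^ (n * n)
  count-avoidsVia {zero} _ _ _ = cong (1 *_) (count-true (n * n))
  count-avoidsVia {suc m} {u} {v} u≢v ws ws-inj
    with commonNeighbour G u v (ws zero) in common | count-avoidsVia u≢v (ws ∘ suc) (suc-injective ∘ ws-inj)
  ... | false | ih = trans
    (cong (4 ^ countTrue (commonNeighbour G u v ∘ ws ∘ suc) *_) (count-cong (λ c →
      cong (λ b → not (b ∨ anyFin (twoPath c u v ∘ ws ∘ suc))) (twoPath-uncommon c common))))
    ih
  ... | true  | ih = proportion-trans {4} {3} {4 ^ k} {3 ^ k} {count (avoidsVia u v ws)}
                                      {count (avoidsVia u v (ws ∘ suc))} {2 ^ (n * n)}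
    (trans (cong (4 *_) (count-cong (λ c → not-∨ (twoPath c u v (ws zero)) (anyFin (twoPath c u v ∘ ws ∘ suc)))))
           (count-avoid-twoPath u≢v common (avoidsVia-independent (ws ∘ suc) (proj₁ ∘ fresh))
                                           (avoidsVia-independent (ws ∘ suc) (proj₂ ∘ fresh))))
    ih
    where
    k = countTrue (commonNeighbour G u v ∘ ws ∘ suc)
    fresh : ∀ j → IndependentOf (key u (ws zero)) (λ c → twoPath c u v (ws (suc j))) ×
                  IndependentOf (key (ws zero) v) (λ c → twoPath c u v (ws (suc j)))
    fresh j = twoPath-independent u≢v common (0≢1+n ∘ ws-inj)

  count-unreachable : ∀ {u v k} → u ≢ v → k ≤ countTrue (commonNeighbour G u v) →
    4 ^ k * count (λ c → not (reaches≤2 c u v)) ≤ 3 ^ k * 2 ^ (n * n)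
  count-unreachable {u} {v} u≢v k≤common = ≤-ratio^-weaken (n≤1+n 3) k≤common (begin
    4 ^ l * count (λ c → not (reaches≤2 c u v))  ≤⟨ *-monoʳ-≤ (4 ^ l) (count-mono unreachable⇒avoids) ⟩
    4 ^ l * count (avoidsVia u v (λ w → w))      ≡⟨ count-avoidsVia u≢v (λ w → w) (λ eq → eq) ⟩
    3 ^ l * 2 ^ (n * n)                          ∎)
    where
    open ≤-Reasoning
    l = countTrue (commonNeighbour G u v)
    unreachable⇒avoids : ∀ c → not (reaches≤2 c u v) ≡ true → avoidsVia u v (λ w → w) c ≡ true
    unreachable⇒avoids c r = ∧-conicalʳ (not (arcOf c u v)) _ (trans (sym (not-∨ (arcOf c u v) _)) r)


module _ {m : ℕ} (G : Graph (suc m)) where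

  missed : Coins G → Fin (suc m) → Fin m → Bool
  missed c u j = not (reaches≤2 G c u (punchIn u j))

  someMissed : Coins G → Bool
  someMissed c = anyFin (λ u → anyFin (missed c u))

  count-someMissed : ∀ {k} → (∀ u v → k ≤ countTrue (commonNeighbour G u v)) →
    4 ^ k * count someMissed ≤ suc m * (m * (3 ^ k * 2 ^ (suc m * suc m)))
  count-someMissed {k} k≤common =
    count-anyFin (4 ^ k) _ (λ u c → anyFin (missed c u)) (λ u →
      count-anyFin (4 ^ k) _ (λ j c → missed c u j) (λ j →
        count-unreachable G (punchInᵢ≢i u j ∘ sym) (k≤common u (punchIn u j))))

  noneMissed⇒Reach≤2 : ∀ c → someMissed c ≡ false → ∀ u v → u ≢ v → Reach≤2 (orientation G c) u v
  noneMissed⇒Reach≤2 c none u v u≢v = reaches≤2-sound G c u v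
    (subst (λ v → reaches≤2 G c u v ≡ true) (punchIn-punchOut u≢v)
      (not-injective (anyFin-false (missed c u)
        (anyFin-false (λ u → anyFin (missed c u)) none u) (punchOut u≢v))))

theorem1 : (m : ℕ) (G : Graph (suc m)) →
    DegreeCondition (suc m) (minDegree G) →
    ∃ λ (D : Orientation G) → HasDiameterTwo D
theorem1 zero G (1≤2δ , _) = contradiction (subst (λ δ → 1 ≤ 2 * δ) (minDegree-single G) 1≤2δ) λ ()
theorem1 (suc m) G (_ , n²3ᵏ≤4ᵏ) =
  let c , noneMissed = count<2^N⇒∃ (someMissed G) fewMissed
  in orientation G c , noneMissed⇒Reach≤2 G c noneMissed , ∃-non-arc (orientation G c)
  where
  n = suc (suc m)
  k = 2 * minDegree G ∸ n
  fewMissed : count (someMissed G) < 2 ^ (n * n)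
  fewMissed = union-bound-< (suc m) (m^n>0 3 k) (m^n>0 2 (n * n)) n²3ᵏ≤4ᵏ
    (count-someMissed G (commonNeighbours-≥ G))
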